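{- For every $k\in\mathbb{N}_0$ we have $\mathcal{PC}_k\subsetneq\mathcal{UC}_k\subsetneq\mathcal{PC}_{k+1}$.
   Context: Clauses, clause-sets (CNF), partial assignments and their application $\varphi*F$ as usual; a literal $x$ is forced for $F$ if $\langle x\to0\rangle*F$ is unsatisfiable. Reductions $r_k$: $r_0(F)=\{\bot\}$ if $\bot\in F$, else $F$; $r_{k+1}(F)=r_{k+1}(\langle x\to1\rangle*F)$ if some literal $x$ over $\mathrm{var}(F)$ has $r_k(\langle x\to0\rangle*F)=\{\bot\}$, else $F$. $\mathrm{hd}(F)$ is the least $k$ such that $r_k(\varphi*F)=\{\bot\}$ for all partial assignments $\varphi$ with $\varphi*F$ unsatisfiable; $\mathrm{phd}(F)$ is the least $k$ such that for all partial $\varphi$: if $\varphi*F$ is unsatisfiable then $r_k(\varphi*F)=\{\bot\}$, otherwise $r_k(\varphi*F)$ has no forced literals. $\mathcal{UC}_k=\{F:\mathrm{hd}(F)\le k\}$, $\mathcal{PC}_k=\{F:\mathrm{phd}(F)\le k\}$. -}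

module Defs where

open import Data.Nat using (ℕ; zero; suc; _≤_; _≡ᵇ_)
open import Data.Bool using (Bool; true; false; not; if_then_else_; _∧_; _∨_)
open import Data.Maybe using (Maybe; just; nothing)
open import Data.Product using (Σ; _×_; _,_; proj₁; proj₂)
open import Data.List using (List; []; _∷_; concat; length; null)
open import Data.List.Relation.Unary.All using (All)
open import Data.List.Relation.Unary.Any using (Any)
open import Data.List.Membership.Propositional using (_∈_)
open import Relation.Nullary using (¬_)
open import Relation.Nullary.Decidable using (does)
open import Relation.Binary.PropositionalEquality using (_≡_)
open import Data.Bool.Properties using () renaming (_≟_ to _≟B_)

-- Variables are natural numbers; a literal is a variable with a sign
-- (true = positive literal v, false = negative literal ¬v).

Var : Set
Var = ℕ

Lit : Set
Lit = Var × Bool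

var : Lit → Var
var = proj₁

sign : Lit → Bool
sign = proj₂

-- A clause is a finite set of literals, represented by a list
-- (duplicates are semantically irrelevant); ⊥ is the empty clause.
Clause : Set
Clause = List Lit

CS : Set
CS = List Clause

-- "As usual": clauses contain no clashing (complementary) literals.
WFClause : Clause → Set
WFClause C = ∀ {l l'} → l ∈ C → l' ∈ C → var l ≡ var l' → sign l ≡ sign l'

WF : CS → Set
WF F = All WFClause F

anyᵇ : {A : Set} → (A → Bool) → List A → Bool
anyᵇ p [] = false
anyᵇ p (x ∷ xs) = p x ∨ anyᵇ p xs

allᵇ : {A : Set} → (A → Bool) → List A → Bool
allᵇ p [] = true
allᵇ p (x ∷ xs) = p x ∧ allᵇ p xs

filterᵇ : {A : Set} → (A → Bool) → List A → List A
filterᵇ p [] = []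
filterᵇ p (x ∷ xs) = if p x then x ∷ filterᵇ p xs else filterᵇ p xs

PAss : Set
PAss = Var → Maybe Bool

litTrue : PAss → Lit → Bool
litTrue φ (v , s) with φ v
... | just b  = does (b ≟B s)
... | nothing = false

assigned : PAss → Lit → Bool
assigned φ (v , s) with φ v
... | just _  = true
... | nothing = false

apply : PAss → CS → CS
apply φ [] = []
apply φ (C ∷ F) with anyᵇ (litTrue φ) C
... | true  = apply φ F
... | false = filterᵇ (λ l → not (assigned φ l)) C ∷ apply φ F

-- ⟨x → ε⟩ for a literal x: the variable of x gets the value making x equal ε.
⟨_↦_⟩ : Lit → Bool → PAss
⟨ (v , s) ↦ ε ⟩ w = if v ≡ᵇ w then just (if s then ε else not ε) else nothing

Sat : CS → Set
Sat F = Σ (Var → Bool) λ β → All (λ C → Any (λ l → β (var l) ≡ sign l) C) F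

Unsat : CS → Set
Unsat F = ¬ Sat F

Forced : CS → Lit → Set
Forced F x = Unsat (apply ⟨ x ↦ false ⟩ F)

-- F = {⊥} as a set of clauses: nonempty and every clause is the empty clause.
isBot : CS → Bool
isBot F = not (null F) ∧ allᵇ null F

litsOver : CS → List Lit
litsOver F = go (concat F)
  where
  go : List Lit → List Lit
  go [] = []
  go ((v , _) ∷ ls) = (v , true) ∷ (v , false) ∷ go ls

findLit : (Lit → Bool) → List Lit → Maybe Lit
findLit p [] = nothing
findLit p (x ∷ xs) = if p x then just x else findLit p xs

-- number of literal occurrences: an upper bound on the number of
-- elimination steps of r_{k+1} (each step removes a variable of F)
size : CS → ℕ
size [] = 0
size (C ∷ F) = length C Data.Nat.+ size F
  where import Data.Nat

mutual
  r : ℕ → CS → CS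
  r zero F = if anyᵇ null F then ([] ∷ []) else F
  r (suc k) F = step k (size F) F

  step : ℕ → ℕ → CS → CS
  step k zero F = F
  step k (suc n) F with findLit (λ x → isBot (r k (apply ⟨ x ↦ false ⟩ F))) (litsOver F)
  ... | just x  = step k n (apply ⟨ x ↦ true ⟩ F)
  ... | nothing = F

HdAt : ℕ → CS → Set
HdAt k F = ∀ (φ : PAss) → Unsat (apply φ F) → isBot (r k (apply φ F)) ≡ true

PhdAt : ℕ → CS → Set
PhdAt k F = ∀ (φ : PAss) →
  (Unsat (apply φ F) → isBot (r k (apply φ F)) ≡ true) ×
  (¬ Unsat (apply φ F) → ∀ (x : Lit) → ¬ Forced (r k (apply φ F)) x)

-- UC_k = { F : hd(F) ≤ k },  hd(F) = least j with HdAt j F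
UC : ℕ → CS → Set
UC k F = Σ ℕ λ j → j ≤ k × HdAt j F

-- PC_k = { F : phd(F) ≤ k },  phd(F) = least j with PhdAt j F
PC : ℕ → CS → Set
PC k F = Σ ℕ λ j → j ≤ k × PhdAt j F

module Submission where

-- The run of r_{k+1} on a clause-set G is analysed once (`r-reduct`):
-- r_{k+1}(G) = ρ*G for a partial assignment ρ that preserves
-- satisfiability, and ρ*G is k-stable, i.e. no literal x over var(ρ*G)
-- has r_k(⟨x→0⟩*ρ*G) = {⊥}.  From this normal form we get soundness of
-- r_k, monotonicity of hardness (hd ≤ k ⇒ hd ≤ k+1), and the fact that
-- for hd(F) ≤ k the reduct r_{k+1}(φ*F) of a satisfiable φ*F has no
-- forced literal; hence UC_k ⊆ PC_{k+1}, while PC_k ⊆ UC_k is immediate.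
-- For strictness two more facts are proved: r_k fixes clause-sets whose
-- clauses all have more than k distinct variables (`wide-fixed`), and r_m
-- refutes unsatisfiable clause-sets on at most m variables
-- (`few-vars-refuted`).  The full clause-set on k+1 variables then lies in
-- PC_{k+1} \ UC_k, and the full clause-set on k variables with the literal
-- x_k added to every clause lies in UC_k \ PC_k (x_k is forced, but r_k
-- leaves the clause-set unchanged).

open import Defs
open import Function using (_∘_; id)
open import Data.Nat using (ℕ; zero; suc; _≤_; _<_; _≤′_; ≤′-refl; ≤′-step; z≤n; s≤s; _≡ᵇ_)
open import Data.Nat.Properties
  using (_≟_; ≤-refl; ≤-reflexive; ≤-trans; ≤-pred; <-≤-trans; n≮0; ≤⇒≤′; m≤n⇒m≤1+n;
         n≤1+n; m<n⇒m<1+n; <⇒≢; ≤∧≢⇒<; m≤n+m; +-mono-≤; +-mono-<-≤; +-mono-≤-<)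
open import Data.Bool using (Bool; true; false; not; if_then_else_; _∨_; _∧_)
open import Data.Bool.Properties using (∨-conicalˡ; ∨-conicalʳ; ∨-identityʳ) renaming (_≟_ to _≟B_)
open import Data.Maybe using (just; nothing; fromMaybe; _<∣>_)
open import Data.Product using (Σ; _×_; _,_; proj₁; proj₂)
open import Data.Product.Properties using (≡-dec)
open import Data.Sum using (_⊎_; inj₁; inj₂)
open import Data.Unit using (tt; ⊤)
open import Data.Empty using (⊥-elim)
open import Data.List using (List; []; _∷_; length; null; map; _++_; filter; downFrom)
open import Data.List.Properties using (filter-notAll; length-downFrom)
open import Data.List.Relation.Unary.All as All using (All; []; _∷_)
open import Data.List.Relation.Unary.All.Properties as AllP using (¬Any⇒All¬)
open import Data.List.Relation.Unary.Any as Any using (Any; here; there)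
open import Data.List.Membership.Propositional using (_∈_)
open import Data.List.Membership.DecPropositional (≡-dec _≟_ _≟B_) using (_∈?_)
open import Data.List.Membership.Propositional.Properties using (∈-filter⁺; ∈-downFrom⁺)
open import Relation.Nullary using (¬_; yes; no; does; proof; ¬?)
open import Relation.Nullary.Reflects using (Reflects; ofʸ; ofⁿ)
open import Relation.Nullary.Decidable using (dec-true)
open import Relation.Binary.PropositionalEquality

true≢false : ¬ true ≡ false
true≢false ()

∨-true : ∀ {a b} → a ∨ b ≡ true → a ≡ true ⊎ b ≡ true
∨-true {true}  _ = inj₁ refl
∨-true {false} e = inj₂ e

∨-swap : ∀ a b c → a ∨ (b ∨ c) ≡ b ∨ (a ∨ c)
∨-swap true true  c = refl
∨-swap true false c = refl
∨-swap false b    c = refl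

≡ᵇ-reflects : ∀ m n → Reflects (m ≡ n) (m ≡ᵇ n)
≡ᵇ-reflects m n = proof (m ≟ n)

Any-nonempty : ∀ {A : Set} {P : A → Set} {xs} → Any P xs → 0 < length xs
Any-nonempty (here _)  = s≤s z≤n
Any-nonempty (there _) = s≤s z≤n

module _ {A : Set} where

  anyᵇ-true : ∀ (p : A → Bool) xs → anyᵇ p xs ≡ true → Any (λ x → p x ≡ true) xs
  anyᵇ-true p [] ()
  anyᵇ-true p (y ∷ ys) e with ∨-true {p y} e
  ... | inj₁ py   = here py
  ... | inj₂ rest = there (anyᵇ-true p ys rest)

  anyᵇ-false : ∀ (p : A → Bool) {P : A → Set} xs → anyᵇ p xs ≡ false →
    Any P xs → Any (λ x → p x ≡ false × P x) xs
  anyᵇ-false p (y ∷ ys) e (here py) = here (∨-conicalˡ (p y) _ e , py)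
  anyᵇ-false p (y ∷ ys) e (there a) = there (anyᵇ-false p ys (∨-conicalʳ (p y) _ e) a)

  anyᵇ-none : ∀ (p : A → Bool) {xs} → All (λ x → p x ≡ false) xs → anyᵇ p xs ≡ false
  anyᵇ-none p []       = refl
  anyᵇ-none p (e ∷ es) rewrite e = anyᵇ-none p es

  filterᵇ-Any⁺ : ∀ (q : A → Bool) {P : A → Set} xs →
    Any (λ x → q x ≡ true × P x) xs → Any P (filterᵇ q xs)
  filterᵇ-Any⁺ q (y ∷ ys) a with q y in e
  filterᵇ-Any⁺ q (y ∷ ys) (here (_ , py)) | true  = here py
  filterᵇ-Any⁺ q (y ∷ ys) (there a)       | true  = there (filterᵇ-Any⁺ q ys a)
  filterᵇ-Any⁺ q (y ∷ ys) (here (qy , _)) | false = ⊥-elim (true≢false (trans (sym qy) e))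
  filterᵇ-Any⁺ q (y ∷ ys) (there a)       | false = filterᵇ-Any⁺ q ys a

  filterᵇ-Any⁻ : ∀ (q : A → Bool) {P : A → Set} xs →
    Any P (filterᵇ q xs) → Any (λ x → q x ≡ true × P x) xs
  filterᵇ-Any⁻ q (y ∷ ys) a with q y in e
  filterᵇ-Any⁻ q (y ∷ ys) (here py) | true = here (e , py)
  filterᵇ-Any⁻ q (y ∷ ys) (there a) | true = there (filterᵇ-Any⁻ q ys a)
  ... | false = there (filterᵇ-Any⁻ q ys a)

  filterᵇ-All : ∀ (q : A → Bool) {P Q : A → Set} xs →
    (∀ {x} → P x → q x ≡ true → Q x) → All P xs → All Q (filterᵇ q xs)
  filterᵇ-All q [] f [] = []
  filterᵇ-All q (y ∷ ys) f (py ∷ ps) with q y in e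
  ... | true  = f py e ∷ filterᵇ-All q ys f ps
  ... | false = filterᵇ-All q ys f ps

  filterᵇ-keep : ∀ (q : A → Bool) {xs} → All (λ x → q x ≡ true) xs → filterᵇ q xs ≡ xs
  filterᵇ-keep q [] = refl
  filterᵇ-keep q {y ∷ ys} (e ∷ es) rewrite e = cong (y ∷_) (filterᵇ-keep q es)

  length-filterᵇ-≤ : ∀ (q : A → Bool) xs → length (filterᵇ q xs) ≤ length xs
  length-filterᵇ-≤ q [] = z≤n
  length-filterᵇ-≤ q (y ∷ ys) with q y
  ... | true  = s≤s (length-filterᵇ-≤ q ys)
  ... | false = ≤-trans (length-filterᵇ-≤ q ys) (n≤1+n _)

  length-filterᵇ-< : ∀ (q : A → Bool) xs → Any (λ x → q x ≡ false) xs →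
    length (filterᵇ q xs) < length xs
  length-filterᵇ-< q (y ∷ ys) a with q y in e
  length-filterᵇ-< q (y ∷ ys) (here qy) | true = ⊥-elim (true≢false (trans (sym e) qy))
  length-filterᵇ-< q (y ∷ ys) (there a) | true = s≤s (length-filterᵇ-< q ys a)
  ... | false = s≤s (length-filterᵇ-≤ q ys)

findLit-just : ∀ p xs {x} → findLit p xs ≡ just x → x ∈ xs × p x ≡ true
findLit-just p (y ∷ ys) e with p y in py
findLit-just p (y ∷ ys) refl | true = here refl , py
... | false = let (x∈ , px) = findLit-just p ys e in there x∈ , px

findLit-nothing : ∀ p xs → findLit p xs ≡ nothing → ∀ {x} → x ∈ xs → p x ≡ false
findLit-nothing p (y ∷ ys) e x∈ with p y in py
findLit-nothing p (y ∷ ys) () x∈ | true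
findLit-nothing p (y ∷ ys) e (here refl) | false = py
findLit-nothing p (y ∷ ys) e (there x∈) | false = findLit-nothing p ys e x∈

-- Algebra of partial assignments

apply-∷ : ∀ φ C F → apply φ (C ∷ F) ≡
  (if anyᵇ (litTrue φ) C then apply φ F
   else (filterᵇ (λ l → not (assigned φ l)) C ∷ apply φ F))
apply-∷ φ C F with anyᵇ (litTrue φ) C
... | true  = refl
... | false = refl

_▷_ : PAss → PAss → PAss
(ψ ▷ ρ) v = ψ v <∣> ρ v

litTrue-▷ : ∀ ψ ρ l → litTrue (ψ ▷ ρ) l ≡ (litTrue ψ l ∨ (not (assigned ψ l) ∧ litTrue ρ l))
litTrue-▷ ψ ρ (v , s) with ψ v
... | just b  = sym (∨-identityʳ _)
... | nothing = refl

assigned-▷ : ∀ ψ ρ l → assigned (ψ ▷ ρ) l ≡ (assigned ψ l ∨ assigned ρ l)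
assigned-▷ ψ ρ (v , s) with ψ v
... | just b  = refl
... | nothing = refl

anyᵇ-▷ : ∀ ψ ρ C → anyᵇ (litTrue (ψ ▷ ρ)) C ≡
  (anyᵇ (litTrue ψ) C ∨ anyᵇ (litTrue ρ) (filterᵇ (λ l → not (assigned ψ l)) C))
anyᵇ-▷ ψ ρ [] = refl
anyᵇ-▷ ψ ρ (l ∷ C) rewrite litTrue-▷ ψ ρ l | anyᵇ-▷ ψ ρ C with litTrue ψ l | assigned ψ l
... | true  | _     = refl
... | false | true  = refl
... | false | false = ∨-swap (litTrue ρ l) (anyᵇ (litTrue ψ) C) _

filterᵇ-▷ : ∀ ψ ρ C →
  filterᵇ (λ l → not (assigned ρ l)) (filterᵇ (λ l → not (assigned ψ l)) C)
  ≡ filterᵇ (λ l → not (assigned (ψ ▷ ρ) l)) C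
filterᵇ-▷ ψ ρ [] = refl
filterᵇ-▷ ψ ρ (l ∷ C) rewrite assigned-▷ ψ ρ l with assigned ψ l
... | true = filterᵇ-▷ ψ ρ C
... | false with assigned ρ l
...   | true  = filterᵇ-▷ ψ ρ C
...   | false = cong (l ∷_) (filterᵇ-▷ ψ ρ C)

compose : ∀ ψ ρ F → apply ρ (apply ψ F) ≡ apply (ψ ▷ ρ) F
compose ψ ρ [] = refl
compose ψ ρ (C ∷ F) rewrite apply-∷ (ψ ▷ ρ) C F | anyᵇ-▷ ψ ρ C with anyᵇ (litTrue ψ) C
... | true = compose ψ ρ F
... | false with anyᵇ (litTrue ρ) (filterᵇ (λ l → not (assigned ψ l)) C)
...   | true  = compose ψ ρ F
...   | false = cong₂ _∷_ (filterᵇ-▷ ψ ρ C) (compose ψ ρ F)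

unassigned-not-true : ∀ φ l → assigned φ l ≡ false → litTrue φ l ≡ false
unassigned-not-true φ (v , s) e with φ v
... | nothing = refl

apply-untouched : ∀ φ G → All (All (λ l → assigned φ l ≡ false)) G → apply φ G ≡ G
apply-untouched φ [] [] = refl
apply-untouched φ (C ∷ G) (a ∷ as)
  rewrite apply-∷ φ C G | anyᵇ-none (litTrue φ) (All.map (λ {l} → unassigned-not-true φ l) a) =
  cong₂ _∷_ (filterᵇ-keep _ (All.map (cong not) a)) (apply-untouched φ G as)

ε : PAss
ε _ = nothing

apply-ε : ∀ G → apply ε G ≡ G
apply-ε G = apply-untouched ε G (All.tabulate λ _ → All.tabulate λ _ → refl)

⟨⟩-var : ∀ x b → ⟨ x ↦ b ⟩ (var x) ≡ just (if sign x then b else not b)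
⟨⟩-var (v , s) b with v ≡ᵇ v | ≡ᵇ-reflects v v
... | true  | _      = refl
... | false | ofⁿ ne = ⊥-elim (ne refl)

assigned-⟨⟩ : ∀ x b l → var l ≡ var x → assigned ⟨ x ↦ b ⟩ l ≡ true
assigned-⟨⟩ (v , s) b (w , t) e with v ≡ᵇ w | ≡ᵇ-reflects v w
... | true  | _      = refl
... | false | ofⁿ ne = ⊥-elim (ne (sym e))

unassigned-⟨⟩ : ∀ x b l → ¬ var l ≡ var x → assigned ⟨ x ↦ b ⟩ l ≡ false
unassigned-⟨⟩ (v , s) b (w , t) ne with v ≡ᵇ w | ≡ᵇ-reflects v w
... | true  | ofʸ e = ⊥-elim (ne (sym e))
... | false | _     = refl

HasVar : Var → CS → Set
HasVar v G = Any (Any (λ l → var l ≡ v)) G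

apply-novar : ∀ x b G → ¬ HasVar (var x) G → apply ⟨ x ↦ b ⟩ G ≡ G
apply-novar x b G h = apply-untouched _ G
  (All.map (λ {C} ¬a → All.map (λ {l} → unassigned-⟨⟩ x b l) (¬Any⇒All¬ C ¬a)) (¬Any⇒All¬ G h))

SatL : (Var → Bool) → Lit → Set
SatL β l = β (var l) ≡ sign l

Model : (Var → Bool) → CS → Set
Model β F = All (Any (SatL β)) F

Extends : (Var → Bool) → PAss → Set
Extends β φ = ∀ v b → φ v ≡ just b → β v ≡ b

sat-unassigned : ∀ φ β → Extends β φ → ∀ l → SatL β l → litTrue φ l ≡ false →
  not (assigned φ l) ≡ true
sat-unassigned φ β ext (v , s) sat notTrue with φ v in e
... | nothing = refl
... | just b with trans (sym (ext v b e)) sat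
...   | refl = ⊥-elim (true≢false (trans (sym (dec-true (b ≟B b) refl)) notTrue))

sat-down : ∀ φ β → Extends β φ → ∀ G → Model β G → Model β (apply φ G)
sat-down φ β ext [] [] = []
sat-down φ β ext (C ∷ G) (c ∷ m) rewrite apply-∷ φ C G with anyᵇ (litTrue φ) C in e
... | true  = sat-down φ β ext G m
... | false =
  filterᵇ-Any⁺ _ C (Any.map (λ {l} (f , s) → sat-unassigned φ β ext l s f , s)
                           (anyᵇ-false (litTrue φ) C e c))
  ∷ sat-down φ β ext G m

override : PAss → (Var → Bool) → Var → Bool
override ρ β v = fromMaybe (β v) (ρ v)

override-extends : ∀ ρ β → Extends (override ρ β) ρ
override-extends ρ β v b e = cong (fromMaybe (β v)) e

true-sat : ∀ ρ β l → litTrue ρ l ≡ true → SatL (override ρ β) l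
true-sat ρ β (v , s) e with ρ v
true-sat ρ β (v , true)  e  | just true  = refl
true-sat ρ β (v , true)  () | just false
true-sat ρ β (v , false) () | just true
true-sat ρ β (v , false) e  | just false = refl
true-sat ρ β (v , s)     () | nothing

unassigned-sat : ∀ ρ β l → not (assigned ρ l) ≡ true → SatL β l → SatL (override ρ β) l
unassigned-sat ρ β (v , s) e sat with ρ v
unassigned-sat ρ β (v , s) () sat | just _
unassigned-sat ρ β (v , s) e  sat | nothing = sat

sat-up : ∀ ρ β G → Model β (apply ρ G) → Model (override ρ β) G
sat-up ρ β [] m = []
sat-up ρ β (C ∷ G) m rewrite apply-∷ ρ C G with anyᵇ (litTrue ρ) C in e
... | true = Any.map (λ {l} → true-sat ρ β l) (anyᵇ-true (litTrue ρ) C e) ∷ sat-up ρ β G m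
sat-up ρ β (C ∷ G) (c ∷ m) | false =
  Any.map (λ {l} (u , s) → unassigned-sat ρ β l u s) (filterᵇ-Any⁻ _ C c) ∷ sat-up ρ β G m

unsat-apply : ∀ ρ G → Unsat G → Unsat (apply ρ G)
unsat-apply ρ G u (β , m) = u (override ρ β , sat-up ρ β G m)

agrees : ∀ β x → Extends β ⟨ x ↦ does (β (var x) ≟B sign x) ⟩
agrees β (v , s) w c h with v ≡ᵇ w | ≡ᵇ-reflects v w
agrees β (v , s) w c refl | true | ofʸ refl = value (β v) s
  where
  value : ∀ a s → a ≡ (if s then does (a ≟B s)
                            else not (does (a ≟B s)))
  value true  true  = refl
  value true  false = refl
  value false true  = refl
  value false false = refl
agrees β (v , s) w c () | false | _

split-lit : ∀ x G → Unsat (apply ⟨ x ↦ false ⟩ G) → Unsat (apply ⟨ x ↦ true ⟩ G) → Unsat G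
split-lit x G u₀ u₁ (β , m)
  with does (β (var x) ≟B sign x) | agrees β x
... | true  | ext = u₁ (β , sat-down _ β ext G m)
... | false | ext = u₀ (β , sat-down _ β ext G m)

isBot-unsat : ∀ G → isBot G ≡ true → Unsat G
isBot-unsat [] () _
isBot-unsat ([] ∷ G) _ (β , () ∷ _)
isBot-unsat ((l ∷ C) ∷ G) () _

null-unsat : ∀ G → anyᵇ null G ≡ true → Unsat G
null-unsat ([] ∷ G) _ (β , () ∷ _)
null-unsat ((l ∷ C) ∷ G) e (β , _ ∷ m) = null-unsat G e (β , m)

unsat-allnull : ∀ G → allᵇ null G ≡ true → Unsat G → isBot G ≡ true
unsat-allnull [] _ u = ⊥-elim (u ((λ _ → true) , []))
unsat-allnull (C ∷ G) e _ = e

mutual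
  litsOver-var : ∀ {x} G → x ∈ litsOver G → HasVar (var x) G
  litsOver-var (C ∷ G) x∈ with litsOver-var-∷ G C x∈
  ... | inj₁ a = here a
  ... | inj₂ h = there h

  litsOver-var-∷ : ∀ {x} G C → x ∈ litsOver (C ∷ G) →
    Any (λ l → var l ≡ var x) C ⊎ HasVar (var x) G
  litsOver-var-∷ G [] x∈ = inj₂ (litsOver-var G x∈)
  litsOver-var-∷ G (l ∷ C) (here refl) = inj₁ (here refl)
  litsOver-var-∷ G (l ∷ C) (there (here refl)) = inj₁ (here refl)
  litsOver-var-∷ G (l ∷ C) (there (there x∈)) with litsOver-var-∷ G C x∈
  ... | inj₁ a = inj₁ (there a)
  ... | inj₂ h = inj₂ h

mutual
  litsOver-complete : ∀ {v} s G → HasVar v G → (v , s) ∈ litsOver G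
  litsOver-complete s (C ∷ G) h = litsOver-complete-∷ s G C h

  litsOver-complete-∷ : ∀ {v} s G C → HasVar v (C ∷ G) → (v , s) ∈ litsOver (C ∷ G)
  litsOver-complete-∷ s G [] (here ())
  litsOver-complete-∷ s G [] (there h) = litsOver-complete s G h
  litsOver-complete-∷ true  G (l ∷ C) (here (here refl)) = here refl
  litsOver-complete-∷ false G (l ∷ C) (here (here refl)) = there (here refl)
  litsOver-complete-∷ s G (l ∷ C) (here (there a)) =
    there (there (litsOver-complete-∷ s G C (here a)))
  litsOver-complete-∷ s G (l ∷ C) (there h) =
    there (there (litsOver-complete-∷ s G C (there h)))

hasLit : ∀ G → allᵇ null G ≡ true ⊎ Σ Lit (λ x → x ∈ litsOver G)
hasLit [] = inj₁ refl
hasLit ([] ∷ G) = hasLit G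
hasLit ((l ∷ C) ∷ G) = inj₂ ((var l , true) , here refl)

size-apply-≤ : ∀ φ G → size (apply φ G) ≤ size G
size-apply-≤ φ [] = z≤n
size-apply-≤ φ (C ∷ G) rewrite apply-∷ φ C G with anyᵇ (litTrue φ) C
... | true  = ≤-trans (size-apply-≤ φ G) (m≤n+m _ (length C))
... | false = +-mono-≤ (length-filterᵇ-≤ _ C) (size-apply-≤ φ G)

size-apply-< : ∀ φ G → Any (Any (λ l → assigned φ l ≡ true)) G → size (apply φ G) < size G
size-apply-< φ (C ∷ G) h rewrite apply-∷ φ C G with anyᵇ (litTrue φ) C | h
... | true  | here a  = +-mono-<-≤ (Any-nonempty a) (size-apply-≤ φ G)
... | true  | there h' = +-mono-≤-< {0} {length C} z≤n (size-apply-< φ G h')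
... | false | here a  =
  +-mono-<-≤ (length-filterᵇ-< _ C (Any.map (cong not) a)) (size-apply-≤ φ G)
... | false | there h' = +-mono-≤-< (length-filterᵇ-≤ _ C) (size-apply-< φ G h')

-- Hence each iteration of r_{k+1} decreases the size: `size G` steps suffice.
size-litsOver-< : ∀ x b G → x ∈ litsOver G → size (apply ⟨ x ↦ b ⟩ G) < size G
size-litsOver-< x b G x∈ =
  size-apply-< _ G (Any.map (Any.map (λ {l} → assigned-⟨⟩ x b l)) (litsOver-var G x∈))

-- Normal form of r_{k+1}

-- r_k refutes ⟨x→0⟩*G: the test by which r_{k+1} selects literals.
Failed : ℕ → CS → Lit → Bool
Failed k G x = isBot (r k (apply ⟨ x ↦ false ⟩ G))

Stable : ℕ → CS → Set
Stable k G = ∀ {x} → x ∈ litsOver G → Failed k G x ≡ false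

Sound : ℕ → Set
Sound k = ∀ G → isBot (r k G) ≡ true → Unsat G

-- R is the outcome of running r_{k+1} on G: a satisfiability-preserving
-- restriction of G which is k-stable.
record Reduct (k : ℕ) (G R : CS) : Set where
  field
    ρ        : PAss
    is-apply : R ≡ apply ρ G
    sat-kept : Unsat R → Unsat G
    stable   : Stable k R

reduct-refl : ∀ {k G} → Stable k G → Reduct k G G
reduct-refl {G = G} st = record
  { ρ = ε ; is-apply = sym (apply-ε G) ; sat-kept = id ; stable = st }

reduct-lit : ∀ {k G R} x → Unsat (apply ⟨ x ↦ false ⟩ G) →
  Reduct k (apply ⟨ x ↦ true ⟩ G) R → Reduct k G R
reduct-lit {G = G} x u₀ rd = record
  { ρ        = ⟨ x ↦ true ⟩ ▷ ρ
  ; is-apply = trans is-apply (compose _ ρ G)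
  ; sat-kept = λ u → split-lit x G u₀ (sat-kept u)
  ; stable   = stable
  }
  where open Reduct rd

stepView : ∀ k n F →
  (findLit (Failed k F) (litsOver F) ≡ nothing × step k (suc n) F ≡ F) ⊎
  Σ Lit (λ x → findLit (Failed k F) (litsOver F) ≡ just x ×
               step k (suc n) F ≡ step k n (apply ⟨ x ↦ true ⟩ F))
stepView k n F with findLit (Failed k F) (litsOver F)
... | nothing = inj₁ (refl , refl)
... | just x  = inj₂ (x , refl , refl)

step-reduct : ∀ k → Sound k → ∀ n G → size G ≤ n → Reduct k G (step k n G)
step-reduct k sound zero G sz =
  reduct-refl λ x∈ → ⊥-elim (n≮0 (<-≤-trans (size-litsOver-< _ false G x∈) sz))
step-reduct k sound (suc n) G sz with stepView k n G
... | inj₁ (none , eq) =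
  subst (Reduct k G) (sym eq) (reduct-refl (findLit-nothing (Failed k G) (litsOver G) none))
... | inj₂ (x , found , eq) with findLit-just (Failed k G) (litsOver G) found
...   | x∈ , failed =
  subst (Reduct k G) (sym eq) (reduct-lit x (sound _ failed)
    (step-reduct k sound n _ (≤-pred (<-≤-trans (size-litsOver-< x true G x∈) sz))))

r-sound : ∀ k → Sound k
r-sound zero G e with anyᵇ null G in hasEmpty
... | true  = null-unsat G hasEmpty
... | false = isBot-unsat G e
r-sound (suc k) G e =
  Reduct.sat-kept (step-reduct k (r-sound k) (size G) G ≤-refl) (isBot-unsat _ e)

r-reduct : ∀ k G → Reduct k G (r (suc k) G)
r-reduct k G = step-reduct k (r-sound k) (size G) G ≤-refl

reduct-refutes : ∀ {k G R} → Reduct k G R → Unsat G →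
  (∀ ρ {x} → x ∈ litsOver (apply ρ G) → Unsat (apply ⟨ x ↦ false ⟩ (apply ρ G)) →
     Failed k (apply ρ G) x ≡ true) →
  isBot R ≡ true
reduct-refutes {G = G} record { ρ = ρ ; is-apply = refl ; stable = stable } u refuted
  with hasLit (apply ρ G)
... | inj₁ empty    = unsat-allnull _ empty (unsat-apply ρ G u)
... | inj₂ (x , x∈) = ⊥-elim (true≢false (trans
      (sym (refuted ρ x∈ (unsat-apply _ _ (unsat-apply ρ G u)))) (stable x∈)))

-- Hardness: monotonicity, and UC_k ⊆ PC_{k+1}

HdAt-apply : ∀ k F φ → HdAt k F → HdAt k (apply φ F)
HdAt-apply k F φ H ψ =
  subst (λ G → Unsat G → isBot (r k G) ≡ true) (sym (compose φ ψ F)) (H (φ ▷ ψ))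

-- hd ≤ k implies hd ≤ k+1: r_{k+1} can only stop at {⊥}, since on any other
-- reachable unsatisfiable ρ*φ*F each literal x→0 is refuted by r_k.
HdAt-suc : ∀ k F → HdAt k F → HdAt (suc k) F
HdAt-suc k F H φ u = reduct-refutes (r-reduct k (apply φ F)) u
  λ ρ {x} _ → HdAt-apply k (apply φ F) ρ (HdAt-apply k F φ H) ⟨ x ↦ false ⟩

HdAt-mono : ∀ {j k} F → j ≤′ k → HdAt j F → HdAt k F
HdAt-mono F ≤′-refl       H = H
HdAt-mono F (≤′-step j≤k) H = HdAt-suc _ F (HdAt-mono F j≤k H)

-- If hd(G) ≤ k and G is satisfiable, r_{k+1}(G) has no forced literal:
-- a forced literal over var(ρ*G) would have been set by r_{k+1}, and one
-- outside var(ρ*G) would make ρ*G, hence G, unsatisfiable.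
reduct-no-forced : ∀ {k G R} → Reduct k G R → HdAt k G → ¬ Unsat G → ∀ x → ¬ Forced R x
reduct-no-forced {k} {G} record { ρ = ρ ; is-apply = refl ; sat-kept = kept ; stable = stable }
  H sat x forced with x ∈? litsOver (apply ρ G)
... | yes x∈ = true≢false (trans (sym (HdAt-apply k G ρ H ⟨ x ↦ false ⟩ forced)) (stable x∈))
... | no x∉  = sat (kept (subst Unsat
      (apply-novar x false _ (x∉ ∘ litsOver-complete (sign x) _)) forced))

PC⊆UC : ∀ k F → PC k F → UC k F
PC⊆UC k F (j , j≤k , H) = j , j≤k , λ φ → proj₁ (H φ)

UC⊆PC-suc : ∀ k F → UC k F → PC (suc k) F
UC⊆PC-suc k F (j , j≤k , H) = suc k , ≤-refl , λ φ →
  HdAt-mono F (≤⇒≤′ (m≤n⇒m≤1+n j≤k)) H φ ,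
  reduct-no-forced (r-reduct k (apply φ F)) (HdAt-apply k F φ (HdAt-mono F (≤⇒≤′ j≤k) H))

-- Wide clause-sets are fixed by r_k

Distinct : Clause → Set
Distinct [] = ⊤
Distinct (l ∷ C) = All (λ l' → ¬ var l' ≡ var l) C × Distinct C

Wide : ℕ → CS → Set
Wide m G = All (λ C → m ≤ length C × Distinct C) G

distinct-filter : ∀ q C → Distinct C → Distinct (filterᵇ q C)
distinct-filter q [] d = tt
distinct-filter q (l ∷ C) (others , d) with q l
... | true  = filterᵇ-All q C (λ ne _ → ne) others , distinct-filter q C d
... | false = distinct-filter q C d

distinct-WF : ∀ C → Distinct C → WFClause C
distinct-WF (l ∷ C) (others , d) (here refl) (here refl) e = refl
distinct-WF (l ∷ C) (others , d) (here refl) (there l'∈) e = ⊥-elim (All.lookup others l'∈ (sym e))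
distinct-WF (l ∷ C) (others , d) (there l∈) (here refl) e = ⊥-elim (All.lookup others l∈ e)
distinct-WF (l ∷ C) (others , d) (there l∈) (there l'∈) e = distinct-WF C d l∈ l'∈ e

length-unassigned-⟨⟩ : ∀ x b C → Distinct C →
  length C ≤ suc (length (filterᵇ (λ l → not (assigned ⟨ x ↦ b ⟩ l)) C))
length-unassigned-⟨⟩ x b [] _ = z≤n
length-unassigned-⟨⟩ (v , s) b ((w , t) ∷ C) (others , d) with v ≡ᵇ w | ≡ᵇ-reflects v w
... | true  | ofʸ refl = ≤-reflexive (cong (suc ∘ length) (sym (filterᵇ-keep _
      (All.map (λ {l} ne → cong not (unassigned-⟨⟩ (v , s) b l ne)) others))))
... | false | _ = s≤s (length-unassigned-⟨⟩ (v , s) b C d)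

wide-apply-lit : ∀ m x b G → Wide (suc m) G → Wide m (apply ⟨ x ↦ b ⟩ G)
wide-apply-lit m x b [] [] = []
wide-apply-lit m x b (C ∷ G) ((long , d) ∷ w)
  rewrite apply-∷ ⟨ x ↦ b ⟩ C G with anyᵇ (litTrue ⟨ x ↦ b ⟩) C
... | true  = wide-apply-lit m x b G w
... | false = (≤-pred (≤-trans long (length-unassigned-⟨⟩ x b C d)) , distinct-filter _ C d)
              ∷ wide-apply-lit m x b G w

wide-mono : ∀ {a b G} → b ≤ a → Wide a G → Wide b G
wide-mono b≤a = All.map λ (long , d) → ≤-trans b≤a long , d

isBot-wide : ∀ {m G} → Wide (suc m) G → isBot G ≡ false
isBot-wide {G = []} _ = refl
isBot-wide {G = [] ∷ G} ((() , _) ∷ _)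
isBot-wide {G = (l ∷ C) ∷ G} _ = refl

null-wide : ∀ {m G} → Wide (suc m) G → anyᵇ null G ≡ false
null-wide {G = []} _ = refl
null-wide {G = [] ∷ G} ((() , _) ∷ _)
null-wide {G = (l ∷ C) ∷ G} (_ ∷ w) = null-wide w

stable-fixed : ∀ {k G} → Stable k G → ∀ n → step k n G ≡ G
stable-fixed st zero = refl
stable-fixed {k} {G} st (suc n) with stepView k n G
... | inj₁ (_ , eq) = eq
... | inj₂ (x , found , _) = ⊥-elim (true≢false (trans
      (sym (proj₂ (findLit-just (Failed k G) (litsOver G) found)))
      (st (proj₁ (findLit-just (Failed k G) (litsOver G) found)))))

-- If every clause has more than k distinct variables, r_k(G) = G:
-- ⟨x→0⟩*G still has more than k-1 variables per clause, so is not refuted.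
wide-fixed : ∀ k G → Wide (suc k) G → r k G ≡ G
wide-fixed zero G w rewrite null-wide w = refl
wide-fixed (suc k) G w = stable-fixed stable (size G)
  where
  stable : Stable k G
  stable {y} _ = trans (cong isBot (wide-fixed k _ w')) (isBot-wide w')
    where
    w' : Wide (suc k) (apply ⟨ y ↦ false ⟩ G)
    w' = wide-apply-lit (suc k) y false G w

-- Unsatisfiable clause-sets on at most m variables are refuted by r_m

VarsIn : List Var → CS → Set
VarsIn S G = All (All (λ l → var l ∈ S)) G

apply-All : ∀ φ {P Q : Lit → Set} G → (∀ {l} → P l → not (assigned φ l) ≡ true → Q l) →
  All (All P) G → All (All Q) (apply φ G)
apply-All φ [] f [] = []
apply-All φ (C ∷ G) f (a ∷ as) rewrite apply-∷ φ C G with anyᵇ (litTrue φ) C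
... | true  = apply-All φ G f as
... | false = filterᵇ-All _ C f a ∷ apply-All φ G f as

varsIn-apply : ∀ {S} φ G → VarsIn S G → VarsIn S (apply φ G)
varsIn-apply φ G = apply-All φ G λ v∈ _ → v∈

remove : Var → List Var → List Var
remove v = filter (λ w → ¬? (w ≟ v))

varsIn-apply-lit : ∀ S x b G → VarsIn S G → VarsIn (remove (var x) S) (apply ⟨ x ↦ b ⟩ G)
varsIn-apply-lit S x b G = apply-All _ G λ {l} v∈ unset →
  ∈-filter⁺ (λ w → ¬? (w ≟ var x)) v∈
    λ e → true≢false (trans (sym unset) (cong not (assigned-⟨⟩ x b l e)))

hasVar-in : ∀ {S v} G → VarsIn S G → HasVar v G → v ∈ S
hasVar-in {S} (C ∷ G) (a ∷ _) (here h) with All.lookupAny a h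
... | v∈ , e = subst (_∈ S) e v∈
hasVar-in (C ∷ G) (_ ∷ as) (there h) = hasVar-in G as h

remove-< : ∀ {v} S → v ∈ S → length (remove v S) < length S
remove-< S v∈ = filter-notAll _ S (Any.map (λ e ne → ne (sym e)) v∈)

-- If G is unsatisfiable and has at most m variables, r_m(G) = {⊥}: each
-- ⟨x→0⟩*ρ*G considered by r_m has at most m-1 variables (induction on m).
few-vars-refuted : ∀ m S → length S ≤ m → ∀ G → VarsIn S G → Unsat G → isBot (r m G) ≡ true
few-vars-refuted zero (_ ∷ _) () _ _ _
few-vars-refuted zero [] _ [] _ u = ⊥-elim (u ((λ _ → true) , []))
few-vars-refuted zero [] _ ([] ∷ G) _ _ = refl
few-vars-refuted zero [] _ ((l ∷ C) ∷ G) ((() ∷ _) ∷ _) _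
few-vars-refuted (suc m) S len G vs u = reduct-refutes (r-reduct m G) u refuted
  where
  refuted : ∀ ρ {x} → x ∈ litsOver (apply ρ G) → Unsat (apply ⟨ x ↦ false ⟩ (apply ρ G)) →
    Failed m (apply ρ G) x ≡ true
  refuted ρ {x} x∈ = few-vars-refuted m (remove (var x) S) fewer _
    (varsIn-apply-lit S x false _ (varsIn-apply ρ G vs))
    where
    fewer : length (remove (var x) S) ≤ m
    fewer = ≤-pred (<-≤-trans
      (remove-< S (hasVar-in _ (varsIn-apply ρ G vs) (litsOver-var _ x∈))) len)

-- The separating examples

infixr 6 _◁_

_◁_ : Lit → CS → CS
l ◁ G = map (l ∷_) G

◁-model : ∀ {β l} G → SatL β l → Model β (l ◁ G)
◁-model G s = AllP.map⁺ (All.tabulate {xs = G} λ _ → here s)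

◁-drop : ∀ {β l G} → ¬ SatL β l → Model β (l ◁ G) → Model β G
◁-drop ¬s m = All.map (λ { (here s) → ⊥-elim (¬s s) ; (there a) → a }) (AllP.map⁻ m)

full : ℕ → CS
full zero    = [] ∷ []
full (suc n) = (n , true) ◁ full n ++ (n , false) ◁ full n

full-unsat : ∀ n → Unsat (full n)
full-unsat zero (β , (() ∷ []))
full-unsat (suc n) (β , m) with β n in e
... | true  = full-unsat n (β , ◁-drop (λ s → true≢false (trans (sym e) s))
                                        (AllP.++⁻ʳ ((n , true) ◁ full n) m))
... | false = full-unsat n (β , ◁-drop (λ s → true≢false (trans (sym s) e))
                                        (AllP.++⁻ˡ ((n , true) ◁ full n) m))

FullClause : ℕ → Clause → Set
FullClause n C = length C ≡ n × Distinct C × All (λ l → var l < n) C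

FullClause-◁ : ∀ {n C} s → FullClause n C → FullClause (suc n) ((n , s) ∷ C)
FullClause-◁ s (len , d , below) =
  cong suc len , (All.map <⇒≢ below , d) , (≤-refl ∷ All.map m<n⇒m<1+n below)

FullClause-wide : ∀ {n C} → FullClause n C → n ≤ length C × Distinct C
FullClause-wide (len , d , _) = ≤-reflexive (sym len) , d

FullClause-WF : ∀ {n C} → FullClause n C → WFClause C
FullClause-WF {C = C} (_ , d , _) = distinct-WF C d

full-clauses : ∀ n → All (FullClause n) (full n)
full-clauses zero    = (refl , tt , []) ∷ []
full-clauses (suc n) = AllP.++⁺ (AllP.map⁺ (All.map (FullClause-◁ true) (full-clauses n)))
                                (AllP.map⁺ (All.map (FullClause-◁ false) (full-clauses n)))

full-vars : ∀ n → VarsIn (downFrom n) (full n)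
full-vars n = All.map (λ (_ , _ , below) → All.map ∈-downFrom⁺ below) (full-clauses n)

-- full (k+1) is in PC_{k+1}: it has k+1 variables and no satisfiable instance.
full-PC : ∀ k → PC (suc k) (full (suc k))
full-PC k = suc k , ≤-refl , λ φ →
  few-vars-refuted (suc k) (downFrom (suc k)) (≤-reflexive (length-downFrom _)) _
    (varsIn-apply φ _ (full-vars (suc k))) ,
  λ sat → ⊥-elim (sat (unsat-apply φ _ (full-unsat (suc k))))

-- full (k+1) is not in UC_k: r_j with j ≤ k leaves it unchanged.
full-notUC : ∀ k → ¬ UC k (full (suc k))
full-notUC k (j , j≤k , H) = true≢false (begin
  true                      ≡⟨ sym (H ε (subst Unsat (sym (apply-ε G)) (full-unsat (suc k)))) ⟩
  isBot (r j (apply ε G))   ≡⟨ cong (isBot ∘ r j) (apply-ε G) ⟩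
  isBot (r j G)             ≡⟨ cong isBot (wide-fixed j G wide) ⟩
  isBot G                   ≡⟨ isBot-wide wide ⟩
  false                     ∎)
  where
  open ≡-Reasoning
  G : CS
  G = full (suc k)
  wide : Wide (suc j) G
  wide = wide-mono (s≤s j≤k) (All.map FullClause-wide (full-clauses (suc k)))

fullOr : ℕ → CS
fullOr k = (k , true) ◁ full k

fullOr-clauses : ∀ k → All (FullClause (suc k)) (fullOr k)
fullOr-clauses k = AllP.map⁺ (All.map (FullClause-◁ true) (full-clauses k))

fullOr-sat : ∀ k φ → override φ (λ _ → true) k ≡ true → Sat (apply φ (fullOr k))
fullOr-sat k φ xk = override φ _ , sat-down φ _ (override-extends φ _) _ (◁-model (full k) xk)

fullOr-forced : ∀ k → Forced (fullOr k) (k , true)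
fullOr-forced k (β , m) =
  full-unsat k (override ρ β , ◁-drop (λ s → true≢false (trans (sym s) xk)) (sat-up ρ β _ m))
  where
  ρ : PAss
  ρ = ⟨ (k , true) ↦ false ⟩
  xk : override ρ β k ≡ false
  xk = cong (fromMaybe (β k)) (⟨⟩-var (k , true) false)

assigned-just : ∀ φ {v b} s → φ v ≡ just b → assigned φ (v , s) ≡ true
assigned-just φ s e rewrite e = refl

unassigned-below : ∀ {k b} φ → φ k ≡ just b → ∀ {l} → var l < suc k →
  not (assigned φ l) ≡ true → var l ∈ downFrom k
unassigned-below {k} φ e {v , s} v≤k unset = ∈-downFrom⁺ (≤∧≢⇒< (≤-pred v≤k) v≢k)
  where
  v≢k : ¬ v ≡ k
  v≢k refl = true≢false (trans (sym unset) (cong not (assigned-just φ s e)))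

-- fullOr k is in UC_k: unless φ sets x_k to 0, φ*fullOr k is satisfiable,
-- and otherwise it lives on the k variables 0 … k-1.
fullOr-UC : ∀ k → UC k (fullOr k)
fullOr-UC k = k , ≤-refl , H
  where
  H : HdAt k (fullOr k)
  H φ u with φ k in e
  ... | just false = few-vars-refuted k (downFrom k) (≤-reflexive (length-downFrom k)) _
        (apply-All φ (fullOr k) (λ {l} → unassigned-below {k} φ e {l})
                   (All.map (λ (_ , _ , vars) → vars) (fullOr-clauses k))) u
  ... | just true = ⊥-elim (u (fullOr-sat k φ (cong (fromMaybe true) e)))
  ... | nothing   = ⊥-elim (u (fullOr-sat k φ (cong (fromMaybe true) e)))

-- fullOr k is not in PC_k: x_k is forced, yet r_j with j ≤ k leaves
-- fullOr k unchanged.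
fullOr-notPC : ∀ k → ¬ PC k (fullOr k)
fullOr-notPC k (j , j≤k , H) = proj₂ (H ε) sat (k , true) forced
  where
  G : CS
  G = fullOr k
  fixed : r j (apply ε G) ≡ G
  fixed = trans (cong (r j) (apply-ε G))
    (wide-fixed j G (wide-mono (s≤s j≤k) (All.map FullClause-wide (fullOr-clauses k))))
  sat : ¬ Unsat (apply ε G)
  sat u = u (fullOr-sat k ε refl)
  forced : Forced (r j (apply ε G)) (k , true)
  forced = subst (λ R → Forced R (k , true)) (sym fixed) (fullOr-forced k)

corollary4p8 : ∀ (k : ℕ) →
    ((∀ F → WF F → PC k F → UC k F) × Σ CS (λ F → WF F × UC k F × ¬ PC k F))
    × ((∀ F → WF F → UC k F → PC (suc k) F) × Σ CS (λ F → WF F × PC (suc k) F × ¬ UC k F))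
corollary4p8 k =
  ( (λ F _ → PC⊆UC k F)
  , (fullOr k , All.map FullClause-WF (fullOr-clauses k) , fullOr-UC k , fullOr-notPC k))
  , ( (λ F _ → UC⊆PC-suc k F)
    , (full (suc k) , All.map FullClause-WF (full-clauses (suc k)) , full-PC k , full-notUC k))
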